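{- For integers $i,j,d$ with $i\ge j$ and $j-d\ge2$, $\mathrm{occ}(T_{i-d},T_i)=\mathrm{occ}(T_{j-d},T_j)$ and $\mathrm{occ}(\overline{T_{i-d}},T_i)=\mathrm{occ}(\overline{T_{j-d}},T_j)$.
   Context: $\mu(\mathtt{a})=\mathtt{ab}$, $\mu(\mathtt{b})=\mathtt{ba}$, $T_i=\mu^{i-1}(\mathtt{a})$. $\overline{w}$ swaps $\mathtt{a}$ and $\mathtt{b}$ in $w$. $\mathrm{occ}(u,w)$ is the number of (possibly overlapping) occurrences of $u$ in $w$. -}

module Defs where

open import Data.Nat using (ℕ; zero; suc; _+_; _∸_)
open import Data.List using (List; []; _∷_; _++_; concatMap; map)
open import Data.Bool using (Bool; true; false; _∧_)

data Letter : Set where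
  a b : Letter

Word : Set
Word = List Letter

μ₁ : Letter → Word
μ₁ a = a ∷ b ∷ []
μ₁ b = b ∷ a ∷ []

μ : Word → Word
μ = concatMap μ₁

μ^ : ℕ → Word → Word
μ^ zero w = w
μ^ (suc n) w = μ (μ^ n w)

-- T i = μ^(i-1)(a)  (meaningful for i ≥ 1)
T : ℕ → Word
T i = μ^ (i ∸ 1) (a ∷ [])

swapL : Letter → Letter
swapL a = b
swapL b = a

bar : Word → Word
bar = map swapL

eqL : Letter → Letter → Bool
eqL a a = true
eqL b b = true
eqL _ _ = false

isPrefix : Word → Word → Bool
isPrefix [] w = true
isPrefix (x ∷ u) [] = false
isPrefix (x ∷ u) (y ∷ w) = eqL x y ∧ isPrefix u w

occ : Word → Word → ℕ
occ u [] with isPrefix u []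
... | true = 1
... | false = 0
occ u (x ∷ w) with isPrefix u (x ∷ w)
... | true = suc (occ u w)
... | false = occ u w

-- An occurrence of μ(u) at an even position of μ(w) is exactly the image of an occurrence
-- of u in w, since μ compares block by block. If u begins with a block x x̄, then μ(u) begins
-- with x x̄ x̄ x, and the square x̄ x̄ cannot straddle a block boundary, so μ(u) never occurs at
-- an odd position: occ(μ u, μ w) = occ(u, w). For n ≥ 2 both T_n and its complement begin
-- with a block, and T_{k+n} = μ^k(T_n), so shifting both indices by k = i - j changes nothing.
module Submission where

open import Defs
open import Data.Bool using (Bool; true; false; _∧_)
open import Data.Bool.Properties using (∧-zeroʳ; ∧-assoc; ∧-idem)
open import Data.Integer as ℤ using (ℤ; +_; _-_; _≥_; ∣_∣)
open import Data.Integer.Properties using (+-minus-telescope; i≤j⇒0≤j-i; ≤-trans)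
open import Data.Integer.Tactic.RingSolver using (solve-∀)
open import Data.List using ([]; _∷_)
open import Data.Nat using (ℕ; zero; suc; _+_; _≤_; z≤n; s≤s)
open import Data.Nat.Properties using (+-suc)
open import Data.Product using (_×_; _,_)
open import Relation.Binary.PropositionalEquality
  using (_≡_; refl; sym; trans; cong; cong₂; subst; subst₂; module ≡-Reasoning)

open ≡-Reasoning

count : Bool → ℕ
count true  = 1
count false = 0

occ-∷ : ∀ u x w → occ u (x ∷ w) ≡ count (isPrefix u (x ∷ w)) + occ u w
occ-∷ u x w with isPrefix u (x ∷ w)
... | true  = refl
... | false = refl

μ-∷ : ∀ x w → μ (x ∷ w) ≡ x ∷ swapL x ∷ μ w
μ-∷ a w = refl
μ-∷ b w = refl

μ^-suc : ∀ k w → μ^ (suc k) w ≡ μ^ k (μ w)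
μ^-suc zero    w = refl
μ^-suc (suc k) w = cong μ (μ^-suc k w)

μ^-+ : ∀ k m w → μ^ (k + m) w ≡ μ^ k (μ^ m w)
μ^-+ zero    m w = refl
μ^-+ (suc k) m w = cong μ (μ^-+ k m w)

T-+ : ∀ k n → T (k + suc n) ≡ μ^ k (T (suc n))
T-+ k n = trans (cong T (+-suc k n)) (μ^-+ k n (a ∷ []))

bar-μ : ∀ w → bar (μ w) ≡ μ (bar w)
bar-μ []      = refl
bar-μ (a ∷ w) = cong (λ v → b ∷ a ∷ v) (bar-μ w)
bar-μ (b ∷ w) = cong (λ v → a ∷ b ∷ v) (bar-μ w)

bar-μ^ : ∀ k w → bar (μ^ k w) ≡ μ^ k (bar w)
bar-μ^ zero    w = refl
bar-μ^ (suc k) w = trans (bar-μ (μ^ k w)) (cong μ (bar-μ^ k w))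

eqL-swapL : ∀ x y → eqL (swapL x) (swapL y) ≡ eqL x y
eqL-swapL a a = refl
eqL-swapL a b = refl
eqL-swapL b a = refl
eqL-swapL b b = refl

eqL-swapL-exclusive : ∀ x y t → eqL x y ∧ (eqL x (swapL y) ∧ t) ≡ false
eqL-swapL-exclusive a a t = refl
eqL-swapL-exclusive a b t = refl
eqL-swapL-exclusive b a t = refl
eqL-swapL-exclusive b b t = refl

isPrefix-μ : ∀ u w → isPrefix (μ u) (μ w) ≡ isPrefix u w
isPrefix-μ []      w       = refl
isPrefix-μ (x ∷ u) []      rewrite μ-∷ x u = refl
isPrefix-μ (x ∷ u) (y ∷ w) = begin
  isPrefix (μ (x ∷ u)) (μ (y ∷ w))
    ≡⟨ cong₂ isPrefix (μ-∷ x u) (μ-∷ y w) ⟩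
  eqL x y ∧ (eqL (swapL x) (swapL y) ∧ isPrefix (μ u) (μ w))
    ≡⟨ cong₂ (λ p q → eqL x y ∧ (p ∧ q)) (eqL-swapL x y) (isPrefix-μ u w) ⟩
  eqL x y ∧ (eqL x y ∧ isPrefix u w)
    ≡⟨ sym (∧-assoc (eqL x y) (eqL x y) (isPrefix u w)) ⟩
  (eqL x y ∧ eqL x y) ∧ isPrefix u w
    ≡⟨ cong (_∧ isPrefix u w) (∧-idem (eqL x y)) ⟩
  eqL x y ∧ isPrefix u w ∎

data StartsWithBlock : Word → Set where
  block : ∀ x r → StartsWithBlock (x ∷ swapL x ∷ r)

μ-startsWithBlock : ∀ {u} → StartsWithBlock u → StartsWithBlock (μ u)
μ-startsWithBlock (block x r) = subst StartsWithBlock (sym (μ-∷ x (swapL x ∷ r))) (block x _)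

μ^-startsWithBlock : ∀ k {u} → StartsWithBlock u → StartsWithBlock (μ^ k u)
μ^-startsWithBlock zero    s = s
μ^-startsWithBlock (suc k) s = μ-startsWithBlock (μ^-startsWithBlock k s)

bar-startsWithBlock : ∀ {u} → StartsWithBlock u → StartsWithBlock (bar u)
bar-startsWithBlock (block a r) = block b (bar r)
bar-startsWithBlock (block b r) = block a (bar r)

T-startsWithBlock : ∀ {n} → 2 ≤ n → StartsWithBlock (T n)
T-startsWithBlock {suc (suc n)} (s≤s (s≤s _)) =
  subst StartsWithBlock (sym (μ^-suc n (a ∷ []))) (μ^-startsWithBlock n (block a []))

-- The square x̄ x̄ in μ(x x̄ r) = x x̄ x̄ x μ(r) would have to sit on z z̄.
isPrefix-μ-odd : ∀ {u} → StartsWithBlock u → ∀ y w → isPrefix (μ u) (y ∷ μ w) ≡ false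
isPrefix-μ-odd (block x r) y [] rewrite μ-∷ x (swapL x ∷ r) = ∧-zeroʳ (eqL x y)
isPrefix-μ-odd (block x r) y (z ∷ w)
  rewrite μ-∷ x (swapL x ∷ r) | μ-∷ (swapL x) r | μ-∷ z w =
  trans (cong (eqL x y ∧_) (eqL-swapL-exclusive (swapL x) z _)) (∧-zeroʳ (eqL x y))

occ-μ : ∀ {u} → StartsWithBlock u → ∀ w → occ (μ u) (μ w) ≡ occ u w
occ-μ (block x r) [] rewrite μ-∷ x (swapL x ∷ r) = refl
occ-μ {u} s (y ∷ w) = begin
  occ (μ u) (μ (y ∷ w))
    ≡⟨ cong (occ (μ u)) (μ-∷ y w) ⟩
  occ (μ u) (y ∷ swapL y ∷ μ w)
    ≡⟨ occ-∷ (μ u) y (swapL y ∷ μ w) ⟩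
  count (isPrefix (μ u) (y ∷ swapL y ∷ μ w)) + occ (μ u) (swapL y ∷ μ w)
    ≡⟨ cong (_+_ (count (isPrefix (μ u) (y ∷ swapL y ∷ μ w)))) (occ-∷ (μ u) (swapL y) (μ w)) ⟩
  count (isPrefix (μ u) (y ∷ swapL y ∷ μ w)) + (count (isPrefix (μ u) (swapL y ∷ μ w)) + occ (μ u) (μ w))
    ≡⟨ cong₂ (λ p q → count p + (count q + occ (μ u) (μ w))) even (isPrefix-μ-odd s (swapL y) w) ⟩
  count (isPrefix u (y ∷ w)) + occ (μ u) (μ w)
    ≡⟨ cong (_+_ (count (isPrefix u (y ∷ w)))) (occ-μ s w) ⟩
  count (isPrefix u (y ∷ w)) + occ u w
    ≡⟨ occ-∷ u y w ⟨
  occ u (y ∷ w) ∎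
  where
  even : isPrefix (μ u) (y ∷ swapL y ∷ μ w) ≡ isPrefix u (y ∷ w)
  even = trans (cong (isPrefix (μ u)) (sym (μ-∷ y w))) (isPrefix-μ u (y ∷ w))

occ-μ^ : ∀ k {u} → StartsWithBlock u → ∀ w → occ (μ^ k u) (μ^ k w) ≡ occ u w
occ-μ^ zero    s w = refl
occ-μ^ (suc k) s w = trans (occ-μ (μ^-startsWithBlock k s) (μ^ k w)) (occ-μ^ k s w)

occ-T-shift : ∀ k {n m} → 2 ≤ n → 1 ≤ m → occ (T (k + n)) (T (k + m)) ≡ occ (T n) (T m)
occ-T-shift k {suc n} {suc m} 2≤n _ = begin
  occ (T (k + suc n)) (T (k + suc m))       ≡⟨ cong₂ occ (T-+ k n) (T-+ k m) ⟩
  occ (μ^ k (T (suc n))) (μ^ k (T (suc m))) ≡⟨ occ-μ^ k (T-startsWithBlock 2≤n) (T (suc m)) ⟩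
  occ (T (suc n)) (T (suc m))               ∎

occ-bar-T-shift : ∀ k {n m} → 2 ≤ n → 1 ≤ m → occ (bar (T (k + n))) (T (k + m)) ≡ occ (bar (T n)) (T m)
occ-bar-T-shift k {suc n} {suc m} 2≤n _ = begin
  occ (bar (T (k + suc n))) (T (k + suc m))       ≡⟨ cong₂ (λ u w → occ (bar u) w) (T-+ k n) (T-+ k m) ⟩
  occ (bar (μ^ k (T (suc n)))) (μ^ k (T (suc m))) ≡⟨ cong (λ u → occ u (μ^ k (T (suc m)))) (bar-μ^ k (T (suc n))) ⟩
  occ (μ^ k (bar (T (suc n)))) (μ^ k (T (suc m))) ≡⟨ occ-μ^ k (bar-startsWithBlock (T-startsWithBlock 2≤n)) (T (suc m)) ⟩
  occ (bar (T (suc n))) (T (suc m))               ∎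

∣i+j∣≡∣i∣+∣j∣ : ∀ {i j} → ℤ.0ℤ ℤ.≤ i → ℤ.0ℤ ℤ.≤ j → ∣ i ℤ.+ j ∣ ≡ ∣ i ∣ + ∣ j ∣
∣i+j∣≡∣i∣+∣j∣ (ℤ.+≤+ _) (ℤ.+≤+ _) = refl

+m≤i⇒m≤∣i∣ : ∀ {m i} → + m ℤ.≤ i → m ≤ ∣ i ∣
+m≤i⇒m≤∣i∣ (ℤ.+≤+ m≤n) = m≤n

i≡[i-j]+j : ∀ i j → i ≡ (i - j) ℤ.+ j
i≡[i-j]+j = solve-∀

lemma34 : (i j d : ℤ) → j ≥ + 1 → i ≥ j → j - d ≥ + 2 →
    (occ (T ∣ i - d ∣) (T ∣ i ∣) ≡ occ (T ∣ j - d ∣) (T ∣ j ∣))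
    × (occ (bar (T ∣ i - d ∣)) (T ∣ i ∣) ≡ occ (bar (T ∣ j - d ∣)) (T ∣ j ∣))
lemma34 i j d j≥1 i≥j j-d≥2 =
  subst₂ (λ p q → (occ (T p) (T q) ≡ occ (T ∣ j - d ∣) (T ∣ j ∣))
                × (occ (bar (T p)) (T q) ≡ occ (bar (T ∣ j - d ∣)) (T ∣ j ∣)))
    (sym ∣i-d∣≡k+∣j-d∣) (sym ∣i∣≡k+∣j∣)
    ( occ-T-shift k (+m≤i⇒m≤∣i∣ j-d≥2) (+m≤i⇒m≤∣i∣ j≥1)
    , occ-bar-T-shift k (+m≤i⇒m≤∣i∣ j-d≥2) (+m≤i⇒m≤∣i∣ j≥1))
  where
  k : ℕ
  k = ∣ i - j ∣
  0≤i-j : ℤ.0ℤ ℤ.≤ i - j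
  0≤i-j = i≤j⇒0≤j-i i≥j
  ∣i-d∣≡k+∣j-d∣ : ∣ i - d ∣ ≡ k + ∣ j - d ∣
  ∣i-d∣≡k+∣j-d∣ = trans (cong ∣_∣ (sym (+-minus-telescope i j d)))
                        (∣i+j∣≡∣i∣+∣j∣ 0≤i-j (≤-trans (ℤ.+≤+ z≤n) j-d≥2))
  ∣i∣≡k+∣j∣ : ∣ i ∣ ≡ k + ∣ j ∣
  ∣i∣≡k+∣j∣ = trans (cong ∣_∣ (i≡[i-j]+j i j)) (∣i+j∣≡∣i∣+∣j∣ 0≤i-j (≤-trans (ℤ.+≤+ z≤n) j≥1))
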